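{- Let $S=(1,s_2,s_3,\ldots)$ be a packing sequence and $P_n$ a path of order $n\ge 1$. (i) If there exists an index $i$ with $s_i < 2^{i-1}$, and $k=\min\{i : s_i<2^{i-1}\}$, then $\chi_S(P_n) \ge \min\{k, \lfloor \log_2(n)\rfloor + 1\}$. (ii) If $2^{i-1} \le s_i < 2^i$ holds for every $2 \le i \le \lfloor \log_2(n)\rfloor + 1$, then $\chi_S(P_n) = \lfloor \log_2(n)\rfloor + 1$. (iii) If $2^{i-1} \le s_i$ holds for every $2 \le i \le \lfloor \log_2(n)\rfloor + 1$, then $\chi_S(P_n) \ge \lfloor \log_2(n)\rfloor + 1$.
   Context: A packing sequence is a non-decreasing infinite sequence $S=(s_1,s_2,\ldots)$ of positive integers. For a graph $G$, a map $\phi\colon V(G)\to\{1,\ldots,k\}$ is an $S$-packing $k$-coloring if any two distinct vertices $u,v$ with $\phi(u)=\phi(v)=i$ satisfy $d_G(u,v) > s_i$. The $S$-packing chromatic number $\chi_S(G)$ is the least $k$ for which such a coloring exists. $P_n$ denotes the path on $n$ vertices. -}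

module Defs where

open import Data.Nat using (ℕ; zero; suc; _≤_; _<_; ∣_-_∣)
open import Data.Fin using (Fin; toℕ)
open import Data.Product using (_×_; ∃)
open import Relation.Binary.PropositionalEquality using (_≡_; _≢_)

-- A sequence S = (s_1, s_2, ...) is represented as a function s : ℕ → ℕ,
-- with s_i = s i for i ≥ 1 (the value s 0 is irrelevant and never used).
IsPackingSequence : (ℕ → ℕ) → Set
IsPackingSequence s = (∀ i → 1 ≤ i → 1 ≤ s i) × (∀ i → 1 ≤ i → s i ≤ s (suc i))

-- The path P_n: vertex set Fin n, u adjacent to u+1; d(u,v) = |u - v|.
pathDist : {n : ℕ} → Fin n → Fin n → ℕ
pathDist u v = ∣ toℕ u - toℕ v ∣

-- S-packing k-coloring of P_n. Colours 1..k are represented by Fin k,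
-- colour c : Fin k standing for the colour toℕ c + 1.
IsPackingColoring : (s : ℕ → ℕ) (n k : ℕ) → (Fin n → Fin k) → Set
IsPackingColoring s n k φ =
  ∀ u v → u ≢ v → φ u ≡ φ v → s (suc (toℕ (φ u))) < pathDist u v

PackingColorable : (s : ℕ → ℕ) (n k : ℕ) → Set
PackingColorable s n k = ∃ λ (φ : Fin n → Fin k) → IsPackingColoring s n k φ

χS-Path≡ : (s : ℕ → ℕ) (n m : ℕ) → Set
χS-Path≡ s n m = PackingColorable s n m × (∀ k → PackingColorable s n k → m ≤ k)

χS-Path≥ : (s : ℕ → ℕ) (n m : ℕ) → Set
χS-Path≥ s n m = ∀ k → PackingColorable s n k → m ≤ k

-- Lower bound: if s_{c+1} ≥ 2^c for every colour c < m, then every block of 2^m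
-- consecutive vertices of the path contains a vertex of colour ≥ m.  Given such a
-- vertex u of colour exactly m, the block of length 2^m starting right after u
-- contains another one, v; if v also had colour m, the two would be at distance
-- at most 2^m ≤ s_{m+1}.  For m = K no colour ≥ K exists, so a K-colouring forces n < 2^K.
-- Upper bound: colouring vertex x (counted from 1) by the 2-adic valuation of x
-- uses the colours 0, …, ⌊log₂ n⌋, and two vertices of valuation c differ by an
-- even multiple of 2^c, so they are at distance ≥ 2^(c+1) > s_{c+1}.
module Submission where

open import Defs
open import Data.Nat using (ℕ; suc; _≤_; _<_; _∸_; _^_; _⊓_)
open import Data.Nat.Logarithm using (⌊log₂_⌋)
open import Data.Product using (_×_)
open import Relation.Binary.PropositionalEquality using (_≡_)

open import Data.Nat using (zero; _+_; _*_; z≤n; s≤s; ∣_-_∣; ⌊_/2⌋; ⌈_/2⌉; NonZero; >-nonZero; >-nonZero⁻¹)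
open import Data.Nat.Properties
open import Data.Nat.Induction using (<-rec)
open import Data.Nat.Logarithm using (⌊log₂⌋-mono-≤; ⌊log₂⌊n/2⌋⌋≡⌊log₂n⌋∸1; ⌊log₂[2^n]⌋≡n)
open import Data.Fin using (Fin; toℕ; fromℕ<)
open import Data.Fin.Properties using (toℕ-injective; toℕ<n; toℕ-fromℕ<)
open import Data.Product using (∃-syntax; _,_; proj₁; proj₂)
open import Data.Sum using (_⊎_; inj₁; inj₂)
open import Data.Empty using (⊥-elim)
open import Function using (_∘_)
open import Relation.Binary.PropositionalEquality using (refl; sym; trans; cong; subst; _≢_; module ≡-Reasoning)

2*⌊n/2⌋≤n : ∀ n → 2 * ⌊ n /2⌋ ≤ n
2*⌊n/2⌋≤n n = begin
  2 * ⌊ n /2⌋           ≡⟨ cong (⌊ n /2⌋ +_) (+-identityʳ ⌊ n /2⌋) ⟩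
  ⌊ n /2⌋ + ⌊ n /2⌋     ≤⟨ +-monoʳ-≤ ⌊ n /2⌋ (⌊n/2⌋≤⌈n/2⌉ n) ⟩
  ⌊ n /2⌋ + ⌈ n /2⌉     ≡⟨ ⌊n/2⌋+⌈n/2⌉≡n n ⟩
  n                     ∎
  where open ≤-Reasoning

2^⌊log₂n⌋≤n : ∀ n .{{_ : NonZero n}} → 2 ^ ⌊log₂ n ⌋ ≤ n
2^⌊log₂n⌋≤n n = go ⌊log₂ n ⌋ n refl
  where
  go : ∀ k n .{{_ : NonZero n}} → ⌊log₂ n ⌋ ≡ k → 2 ^ k ≤ n
  go zero    n              _    = >-nonZero⁻¹ n
  go (suc k) 1              ()
  go (suc k) m@(suc (suc _)) log≡ = begin
    2 * 2 ^ k        ≤⟨ *-monoʳ-≤ 2 (go k ⌊ m /2⌋ (trans (⌊log₂⌊n/2⌋⌋≡⌊log₂n⌋∸1 m) (cong (_∸ 1) log≡))) ⟩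
    2 * ⌊ m /2⌋      ≤⟨ 2*⌊n/2⌋≤n m ⟩
    m                ∎
    where open ≤-Reasoning

2^m≤n⇒m≤⌊log₂n⌋ : ∀ {m n} → 2 ^ m ≤ n → m ≤ ⌊log₂ n ⌋
2^m≤n⇒m≤⌊log₂n⌋ {m} 2^m≤n = subst (_≤ _) (⌊log₂[2^n]⌋≡n m) (⌊log₂⌋-mono-≤ 2^m≤n)

window-widen : ∀ a m → a + 2 ^ m ≤ a + 2 ^ suc m
window-widen a m = +-monoʳ-≤ a (^-monoʳ-≤ 2 (n≤1+n m))

next-window-inside : ∀ {a u} m → u < a + 2 ^ m → suc u + 2 ^ m ≤ a + 2 ^ suc m
next-window-inside {a} {u} m u<a+2^m = begin
  suc u + 2 ^ m            ≤⟨ +-monoˡ-≤ (2 ^ m) u<a+2^m ⟩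
  a + 2 ^ m + 2 ^ m        ≡⟨ +-assoc a (2 ^ m) (2 ^ m) ⟩
  a + (2 ^ m + 2 ^ m)      ≡⟨ cong (λ x → a + (2 ^ m + x)) (sym (+-identityʳ (2 ^ m))) ⟩
  a + 2 ^ suc m            ∎
  where open ≤-Reasoning

module _ {s : ℕ → ℕ} {n K : ℕ} {φ : Fin n → Fin K} (φ-packing : IsPackingColoring s n K φ) where

  same-colour-far : ∀ {u v} → toℕ u < toℕ v → φ u ≡ φ v → s (suc (toℕ (φ u))) < toℕ v ∸ toℕ u
  same-colour-far {u} {v} u<v φu≡φv =
    subst (s (suc (toℕ (φ u))) <_) (m≤n⇒∣m-n∣≡n∸m (<⇒≤ u<v))
      (φ-packing u v (<⇒≢ u<v ∘ cong toℕ) φu≡φv)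

  colour-not-repeated-within : ∀ {u v m} → 2 ^ m ≤ s (suc m) → toℕ u < toℕ v → toℕ v ≤ toℕ u + 2 ^ m →
    m ≡ toℕ (φ u) → m ≤ toℕ (φ v) → m < toℕ (φ v)
  colour-not-repeated-within {u} {v} {m} 2^m≤s u<v v≤u+2^m m≡φu m≤φv with m≤n⇒m<n∨m≡n m≤φv
  ... | inj₁ m<φv = m<φv
  ... | inj₂ m≡φv = ⊥-elim (<⇒≱ (same-colour-far u<v φu≡φv) v∸u≤s[1+φu])
    where
    φu≡φv : φ u ≡ φ v
    φu≡φv = toℕ-injective (trans (sym m≡φu) m≡φv)
    v∸u≤s[1+φu] : toℕ v ∸ toℕ u ≤ s (suc (toℕ (φ u)))
    v∸u≤s[1+φu] = subst (λ c → toℕ v ∸ toℕ u ≤ s (suc c)) m≡φu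
      (≤-trans (m≤n+o⇒m∸n≤o (toℕ v) (toℕ u) v≤u+2^m) 2^m≤s)

  window-has-colour≥ : ∀ m → (∀ c → c < m → 2 ^ c ≤ s (suc c)) →
    ∀ a → a + 2 ^ m ≤ n → ∃[ u ] (a ≤ toℕ u × toℕ u < a + 2 ^ m × m ≤ toℕ (φ u))
  window-has-colour≥ zero _ a a+1≤n =
    fromℕ< a<n , ≤-reflexive (sym u≡a) , ≤-reflexive (trans (cong suc u≡a) (+-comm 1 a)) , z≤n
    where
    a<n : a < n
    a<n = subst (_≤ n) (+-comm a 1) a+1≤n
    u≡a : toℕ (fromℕ< a<n) ≡ a
    u≡a = toℕ-fromℕ< a<n
  window-has-colour≥ (suc m) doubling a a+2^1+m≤n
    with window-has-colour≥ m (λ c → doubling c ∘ m<n⇒m<1+n) a (≤-trans (window-widen a m) a+2^1+m≤n)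
  ... | u , a≤u , u<a+2^m , m≤φu with m≤n⇒m<n∨m≡n m≤φu
  ...   | inj₁ m<φu = u , a≤u , <-≤-trans u<a+2^m (window-widen a m) , m<φu
  ...   | inj₂ m≡φu
    with window-has-colour≥ m (λ c → doubling c ∘ m<n⇒m<1+n) (suc (toℕ u))
           (≤-trans (next-window-inside m u<a+2^m) a+2^1+m≤n)
  ...     | v , u<v , v<1+u+2^m , m≤φv =
    v , ≤-trans a≤u (<⇒≤ u<v) , <-≤-trans v<1+u+2^m (next-window-inside m u<a+2^m) ,
    colour-not-repeated-within (doubling m ≤-refl) u<v (≤-pred v<1+u+2^m) m≡φu m≤φv

  n<2^K : (∀ c → c < K → 2 ^ c ≤ s (suc c)) → n < 2 ^ K
  n<2^K doubling = ≰⇒> λ 2^K≤n →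
    let u , _ , _ , K≤φu = window-has-colour≥ K doubling 0 2^K≤n in ≤⇒≯ K≤φu (toℕ<n (φ u))

χS-Path≥-of-doubling : ∀ {s n T} → 2 ^ (T ∸ 1) ≤ n → (∀ i → 1 ≤ i → i < T → 2 ^ (i ∸ 1) ≤ s i) →
  χS-Path≥ s n T
χS-Path≥-of-doubling {s} 2^[T∸1]≤n doubling K (_ , φ-packing) = ≮⇒≥ λ K<T →
  <⇒≱ (n<2^K {s} φ-packing (λ c c<K → doubling (suc c) (s≤s z≤n) (≤-<-trans c<K K<T)))
      (≤-trans (^-monoʳ-≤ 2 (∸-monoˡ-≤ 1 K<T)) 2^[T∸1]≤n)

even-or-odd : ∀ x → ∃[ q ] (x ≡ 2 * q ⊎ x ≡ suc (2 * q))
even-or-odd zero = 0 , inj₁ refl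
even-or-odd (suc x) with even-or-odd x
... | q , inj₁ x≡2q   = q , inj₂ (cong suc x≡2q)
... | q , inj₂ x≡1+2q = suc q , inj₁ (trans (cong suc x≡1+2q) (sym (*-suc 2 q)))

record TwoAdic (x : ℕ) : Set where
  constructor twoAdic
  field
    valuation ⌊oddPart/2⌋ : ℕ
    decomposition : x ≡ 2 ^ valuation * suc (2 * ⌊oddPart/2⌋)

open TwoAdic

twoAdic-suc : ∀ x → TwoAdic (suc x)
twoAdic-suc = <-rec (TwoAdic ∘ suc) step
  where
  step : ∀ x → (∀ {y} → y < x → TwoAdic (suc y)) → TwoAdic (suc x)
  step x rec with even-or-odd x
  ... | q , inj₁ x≡2q = twoAdic 0 q (trans (cong suc x≡2q) (sym (+-identityʳ _)))
  ... | q , inj₂ x≡1+2q with rec (subst (q <_) (sym x≡1+2q) (s≤s (m≤n*m q 2)))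
  ...   | twoAdic c r 1+q≡2^c*o = twoAdic (suc c) r (begin
    suc x                        ≡⟨ cong suc x≡1+2q ⟩
    2 + 2 * q                    ≡⟨ *-suc 2 q ⟨
    2 * suc q                    ≡⟨ cong (2 *_) 1+q≡2^c*o ⟩
    2 * (2 ^ c * suc (2 * r))    ≡⟨ *-assoc 2 (2 ^ c) (suc (2 * r)) ⟨
    2 ^ suc c * suc (2 * r)      ∎)
    where open ≡-Reasoning

2^valuation≤ : ∀ {x} (d : TwoAdic x) → 2 ^ valuation d ≤ x
2^valuation≤ (twoAdic c r refl) = m≤m*n (2 ^ c) (suc (2 * r))

same-valuation-far : ∀ {x y} (dx : TwoAdic x) (dy : TwoAdic y) → x ≢ y → valuation dx ≡ valuation dy →
  2 ^ suc (valuation dx) ≤ ∣ x - y ∣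
same-valuation-far (twoAdic c a refl) (twoAdic .c b refl) x≢y refl = begin
  2 ^ suc c                                       ≡⟨ *-comm 2 (2 ^ c) ⟩
  2 ^ c * 2                                       ≤⟨ *-monoʳ-≤ (2 ^ c) (*-monoʳ-≤ 2 1≤∣a-b∣) ⟩
  2 ^ c * (2 * ∣ a - b ∣)                          ≡⟨ cong (2 ^ c *_) (*-distribˡ-∣-∣ 2 a b) ⟩
  2 ^ c * ∣ suc (2 * a) - suc (2 * b) ∣            ≡⟨ *-distribˡ-∣-∣ (2 ^ c) (suc (2 * a)) (suc (2 * b)) ⟩
  ∣ 2 ^ c * suc (2 * a) - 2 ^ c * suc (2 * b) ∣    ∎
  where
  open ≤-Reasoning
  1≤∣a-b∣ : 1 ≤ ∣ a - b ∣
  1≤∣a-b∣ = n≢0⇒n>0 (x≢y ∘ cong (λ q → 2 ^ c * suc (2 * q)) ∘ ∣m-n∣≡0⇒m≡n {a} {b})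

ruler-packingColorable : ∀ {s n} → (∀ i → 1 ≤ i → i ≤ suc ⌊log₂ n ⌋ → s i < 2 ^ i) →
  PackingColorable s n (suc ⌊log₂ n ⌋)
ruler-packingColorable {s} {n} s<2^i = φ , φ-packing
  where
  ν : Fin n → ℕ
  ν u = valuation (twoAdic-suc (toℕ u))
  ν≤⌊log₂n⌋ : ∀ u → ν u ≤ ⌊log₂ n ⌋
  ν≤⌊log₂n⌋ u = 2^m≤n⇒m≤⌊log₂n⌋ (≤-trans (2^valuation≤ (twoAdic-suc (toℕ u))) (toℕ<n u))
  φ : Fin n → Fin (suc ⌊log₂ n ⌋)
  φ u = fromℕ< (s≤s (ν≤⌊log₂n⌋ u))
  φ≡ν : ∀ u → toℕ (φ u) ≡ ν u
  φ≡ν u = toℕ-fromℕ< (s≤s (ν≤⌊log₂n⌋ u))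
  φ-packing : IsPackingColoring s n (suc ⌊log₂ n ⌋) φ
  φ-packing u v u≢v φu≡φv rewrite φ≡ν u = begin-strict
    s (suc (ν u))        <⟨ s<2^i (suc (ν u)) (s≤s z≤n) (s≤s (ν≤⌊log₂n⌋ u)) ⟩
    2 ^ suc (ν u)        ≤⟨ same-valuation-far (twoAdic-suc (toℕ u)) (twoAdic-suc (toℕ v))
                              (u≢v ∘ toℕ-injective ∘ suc-injective)
                              (trans (sym (φ≡ν u)) (trans (cong toℕ φu≡φv) (φ≡ν v))) ⟩
    pathDist u v         ∎
    where open ≤-Reasoning

from-1-by-cases : ∀ {p} {P : ℕ → Set p} → P 1 → (∀ i → 2 ≤ i → P i) → ∀ i → 1 ≤ i → P i
from-1-by-cases P1 _   1             _ = P1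
from-1-by-cases _  P≥2 (suc (suc i)) _ = P≥2 (suc (suc i)) (s≤s (s≤s z≤n))

theorem3p3 : (s : ℕ → ℕ) → IsPackingSequence s → s 1 ≡ 1 → (n : ℕ) → 1 ≤ n →
    ((k : ℕ) → 1 ≤ k → s k < 2 ^ (k ∸ 1) → (∀ i → 1 ≤ i → i < k → 2 ^ (i ∸ 1) ≤ s i) →
      χS-Path≥ s n (k ⊓ suc ⌊log₂ n ⌋))
  × ((∀ i → 2 ≤ i → i ≤ suc ⌊log₂ n ⌋ → 2 ^ (i ∸ 1) ≤ s i × s i < 2 ^ i) →
      χS-Path≡ s n (suc ⌊log₂ n ⌋))
  × ((∀ i → 2 ≤ i → i ≤ suc ⌊log₂ n ⌋ → 2 ^ (i ∸ 1) ≤ s i) →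
      χS-Path≥ s n (suc ⌊log₂ n ⌋))
theorem3p3 s (s≥1 , _) s₁≡1 n 1≤n = part-i , part-ii , part-iii
  where
  instance
    n≢0 : NonZero n
    n≢0 = >-nonZero 1≤n

  -- s k < 2 ^ (k ∸ 1) only makes k the least such index; the bound needs just the minimality.
  part-i : (k : ℕ) → 1 ≤ k → s k < 2 ^ (k ∸ 1) → (∀ i → 1 ≤ i → i < k → 2 ^ (i ∸ 1) ≤ s i) →
    χS-Path≥ s n (k ⊓ suc ⌊log₂ n ⌋)
  part-i k _ _ doubling = χS-Path≥-of-doubling
    (≤-trans (^-monoʳ-≤ 2 (∸-monoˡ-≤ 1 (m⊓n≤n k _))) (2^⌊log₂n⌋≤n n))
    (λ i 1≤i i<T → doubling i 1≤i (<-≤-trans i<T (m⊓n≤m k _)))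

  part-iii : (∀ i → 2 ≤ i → i ≤ suc ⌊log₂ n ⌋ → 2 ^ (i ∸ 1) ≤ s i) → χS-Path≥ s n (suc ⌊log₂ n ⌋)
  part-iii doubling = χS-Path≥-of-doubling (2^⌊log₂n⌋≤n n)
    (from-1-by-cases (λ _ → s≥1 1 ≤-refl) (λ i 2≤i i<T → doubling i 2≤i (<⇒≤ i<T)))

  part-ii : (∀ i → 2 ≤ i → i ≤ suc ⌊log₂ n ⌋ → 2 ^ (i ∸ 1) ≤ s i × s i < 2 ^ i) →
    χS-Path≡ s n (suc ⌊log₂ n ⌋)
  part-ii bounds =
      ruler-packingColorable (from-1-by-cases (λ _ → ≤-reflexive (cong suc s₁≡1)) (λ i 2≤i → proj₂ ∘ bounds i 2≤i))
    , part-iii (λ i 2≤i → proj₁ ∘ bounds i 2≤i)
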